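{- If $G$ is an outerplanar graph on $n$ vertices, then $G$ has at most $2$ vertices $w$ with $d(w)\ge 2\lceil n/6\rceil+3$. In particular, $G$ has at most $2$ vertices $w$ with $d(w)\ge 2\lceil n/6\rceil+4$. -}

module Defs where

open import Data.Nat using (ℕ; _+_; _*_; _≤ᵇ_)
open import Data.Nat.DivMod using (_/_)
open import Data.Bool using (Bool; true; false)
open import Data.Fin using (Fin) renaming (_<_ to _<ᶠ_)
open import Data.List using (List; length; filterᵇ; allFin)
open import Data.Product using (Σ; _×_)
open import Data.Empty using (⊥)
open import Function.Definitions using (Injective)
open import Relation.Binary.PropositionalEquality using (_≡_)

record Graph (n : ℕ) : Set where
  field
    adj     : Fin n → Fin n → Bool
    sym     : ∀ u v → adj u v ≡ adj v u
    irrefl  : ∀ v → adj v v ≡ false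
open Graph public

degree : ∀ {n} → Graph n → Fin n → ℕ
degree {n} G v = length (filterᵇ (adj G v) (allFin n))

-- Outerplanar: the vertices can be placed on a circle (in the cyclic order
-- given by an injective position map pos : Fin n → Fin n, i.e. a permutation)
-- so that the edges, drawn as chords, are pairwise non-crossing. Two chords
-- ab and cd cross iff their endpoints interleave: pos a < pos c < pos b < pos d.
Outerplanar : ∀ {n} → Graph n → Set
Outerplanar {n} G =
  Σ (Fin n → Fin n) λ pos →
    Injective _≡_ _≡_ pos ×
    (∀ a b c d → adj G a b ≡ true → adj G c d ≡ true →
       pos a <ᶠ pos c → pos c <ᶠ pos b → pos b <ᶠ pos d → ⊥)

⌈_/6⌉ : ℕ → ℕ
⌈ n /6⌉ = (n + 5) / 6

#degAtLeast : ∀ {n} → Graph n → ℕ → ℕ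
#degAtLeast {n} G t = length (filterᵇ (λ w → t ≤ᵇ degree G w) (allFin n))

{-# OPTIONS --safe #-}
-- An outerplanar graph has no K₂,₃: if x and y had three common neighbours, two of them
-- would lie on the same side of the chord xy, and their chords to x and y would cross.
-- So any two vertices share at most two neighbours, and the Bonferroni inequality gives
-- d(x) + d(y) + d(z) ≤ n + 6 for distinct x, y, z. Three vertices of degree ≥ t thus
-- force 3t ≤ n + 6, whereas 3(2⌈n/6⌉ + 3) ≥ n + 9.
module Submission where

open import Defs
open import Data.Nat using (ℕ; _+_; _*_; _≤_)
open import Data.Product using (_×_)

open import Level using (Level; 0ℓ; _⊔_)
open import Data.Bool using (Bool; true; false; _∧_; T)
open import Data.Bool.Properties using (T?; T-∧; T-≡)
open import Data.Empty using (⊥; ⊥-elim)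
open import Data.Fin using (Fin) renaming (_<_ to _<ᶠ_)
open import Data.Fin.Properties using (<-cmp)
open import Data.List using (List; []; _∷_; length; filterᵇ; allFin)
open import Data.List.Properties using (length-tabulate)
open import Data.List.Relation.Unary.All using (All; []; _∷_)
open import Data.List.Relation.Unary.All.Properties using (all-filter)
open import Data.List.Relation.Unary.AllPairs using (_∷_)
open import Data.List.Relation.Unary.Unique.Propositional using (Unique)
import Data.List.Relation.Unary.Unique.Propositional.Properties as Unique
open import Data.Nat using (suc; _<_; _≤ᵇ_; z≤n; s≤s; z<s)
open import Data.Nat.DivMod using (_/_; _%_; m≡m%n+[m/n]*n; m%n<n)
open import Data.Nat.Properties
  using ( ≤-refl; ≤-reflexive; ≤-trans; ≤-pred; n≤1+n; <⇒≱; ≤ᵇ⇒≤; m<m+n; module ≤-Reasoning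
        ; +-comm; +-assoc; +-mono-≤; +-monoˡ-≤; +-monoʳ-≤; +-monoʳ-<; +-cancelˡ-≤; *-monoʳ-≤ )
open import Data.Nat.Tactic.RingSolver using (solve-∀)
open import Data.Product using (_,_; swap)
open import Data.Sum using (_⊎_; inj₁; inj₂)
open import Function using (_∘_; id; flip)
open import Function.Bundles using (Equivalence)
open import Function.Definitions using (Injective)
open import Relation.Binary using (Rel; Symmetric; Trichotomous; tri<; tri≈; tri>)
open import Relation.Binary.PropositionalEquality
  using (_≡_; _≢_; refl; trans; subst; subst₂)
open import Relation.Nullary using (¬_; contradiction)

private
  variable
    a p : Level
    A : Set a

AtMostTwo : {A : Set a} → (A → Set p) → Set (a ⊔ p)
AtMostTwo P = ∀ {u v w} → u ≢ v → u ≢ w → v ≢ w → P u → P v → P w → ⊥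

length≤2 : {P : A → Set p} {xs : List A} → Unique xs → All P xs → AtMostTwo P → length xs ≤ 2
length≤2 {xs = []}              _ _ _ = z≤n
length≤2 {xs = _ ∷ []}          _ _ _ = s≤s z≤n
length≤2 {xs = _ ∷ _ ∷ []}      _ _ _ = s≤s (s≤s z≤n)
length≤2 {xs = _ ∷ _ ∷ _ ∷ _} ((u≢v ∷ u≢w ∷ _) ∷ (v≢w ∷ _) ∷ _) (pu ∷ pv ∷ pw ∷ _) atMostTwo =
  ⊥-elim (atMostTwo u≢v u≢w v≢w pu pv pw)

count : (A → Bool) → List A → ℕ
count f xs = length (filterᵇ f xs)

count≤2 : (f : A → Bool) {xs : List A} → Unique xs → AtMostTwo (T ∘ f) → count f xs ≤ 2
count≤2 f {xs} unique = length≤2 (Unique.filter⁺ (T? ∘ f) unique) (all-filter (T? ∘ f) xs)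

indicator : Bool → ℕ
indicator true  = 1
indicator false = 0

count-∷ : (f : A → Bool) (x : A) (xs : List A) → count f (x ∷ xs) ≡ indicator (f x) + count f xs
count-∷ f x xs with f x
... | true  = refl
... | false = refl

indicator-bonferroni : ∀ b c d →
  indicator b + indicator c + indicator d ≤
  1 + indicator (b ∧ c) + indicator (b ∧ d) + indicator (c ∧ d)
indicator-bonferroni true  true  true  = n≤1+n 3
indicator-bonferroni true  true  false = ≤-refl
indicator-bonferroni true  false true  = ≤-refl
indicator-bonferroni true  false false = ≤-refl
indicator-bonferroni false true  true  = ≤-refl
indicator-bonferroni false true  false = ≤-refl
indicator-bonferroni false false true  = ≤-refl
indicator-bonferroni false false false = z≤n

count-bonferroni : (f g h : A → Bool) (xs : List A) →
  count f xs + count g xs + count h xs ≤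
  length xs + count (λ w → f w ∧ g w) xs + count (λ w → f w ∧ h w) xs + count (λ w → g w ∧ h w) xs
count-bonferroni f g h [] = z≤n
count-bonferroni {A = A} f g h (x ∷ xs)
  rewrite count-∷ f x xs | count-∷ g x xs | count-∷ h x xs
        | count-∷ (λ w → f w ∧ g w) x xs | count-∷ (λ w → f w ∧ h w) x xs
        | count-∷ (λ w → g w ∧ h w) x xs
  = subst₂ _≤_
      (regroup₃ (at-x f) (at-x g) (at-x h) (in-xs f) (in-xs g) (in-xs h))
      (regroup₄ 1 (at-x f∧g) (at-x f∧h) (at-x g∧h) (length xs) (in-xs f∧g) (in-xs f∧h) (in-xs g∧h))
      (+-mono-≤ (indicator-bonferroni (f x) (g x) (h x)) (count-bonferroni f g h xs))
  where
  f∧g f∧h g∧h : A → Bool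
  f∧g w = f w ∧ g w
  f∧h w = f w ∧ h w
  g∧h w = g w ∧ h w
  at-x : (A → Bool) → ℕ
  at-x k = indicator (k x)
  in-xs : (A → Bool) → ℕ
  in-xs k = count k xs
  regroup₃ : ∀ b c d B C D → (b + c + d) + (B + C + D) ≡ (b + B) + (c + C) + (d + D)
  regroup₃ = solve-∀
  regroup₄ : ∀ b c d e B C D E →
    (b + c + d + e) + (B + C + D + E) ≡ (b + B) + (c + C) + (d + D) + (e + E)
  regroup₄ = solve-∀

module NonCrossing
  {o ℓ v e} {C : Set o} {_<_ : Rel C ℓ} (compare : Trichotomous _≡_ _<_)
  {V : Set v} (E : Rel V e) (E-sym : Symmetric E) (E-irrefl : ∀ u → ¬ E u u)
  (pos : V → C) (pos-injective : Injective _≡_ _≡_ pos)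
  (noncrossing : ∀ {a b c d} → E a b → E c d → pos a < pos c → pos c < pos b → pos b < pos d → ⊥)
  where

  wlog-< : ∀ {q} (Q : Rel V q) → Symmetric Q → (∀ {u w} → pos u < pos w → Q u w) →
           ∀ {u w} → u ≢ w → Q u w
  wlog-< Q Q-sym Q-< {u} {w} u≢w with compare (pos u) (pos w)
  ... | tri< u<w _ _ = Q-< u<w
  ... | tri≈ _ u≈w _ = contradiction (pos-injective u≈w) u≢w
  ... | tri> _ _ w<u = Q-sym (Q-< w<u)

  Common : V → V → V → Set e
  Common x y u = E x u × E y u

  module _ {x y : V} (x<y : pos x < pos y) where

    Inside Outside : V → Set (e ⊔ ℓ)
    Inside u = Common x y u × pos x < pos u × pos u < pos y
    Outside u = Common x y u × (pos u < pos x ⊎ pos y < pos u)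

    inside-or-outside : ∀ {u} → Common x y u → Inside u ⊎ Outside u
    inside-or-outside {u} c@(xu , yu) with compare (pos u) (pos x)
    ... | tri< u<x _ _ = inj₂ (c , inj₁ u<x)
    ... | tri≈ _ u≈x _ = ⊥-elim (E-irrefl x (subst (E x) (pos-injective u≈x) xu))
    ... | tri> _ _ x<u with compare (pos u) (pos y)
    ...   | tri< u<y _ _ = inj₁ (c , x<u , u<y)
    ...   | tri≈ _ u≈y _ = ⊥-elim (E-irrefl y (subst (E y) (pos-injective u≈y) yu))
    ...   | tri> _ _ y<u = inj₂ (c , inj₂ y<u)

    at-most-one-inside : ∀ {u w} → u ≢ w → Inside u → Inside w → ⊥
    at-most-one-inside = wlog-< (λ u w → Inside u → Inside w → ⊥) flip inside-<
      where
      inside-< : ∀ {u w} → pos u < pos w → Inside u → Inside w → ⊥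
      inside-< u<w ((_ , yu) , x<u , _) ((xw , _) , _ , w<y) = noncrossing xw (E-sym yu) x<u u<w w<y

    at-most-one-outside : ∀ {u w} → u ≢ w → Outside u → Outside w → ⊥
    at-most-one-outside = wlog-< (λ u w → Outside u → Outside w → ⊥) flip outside-<
      where
      outside-< : ∀ {u w} → pos u < pos w → Outside u → Outside w → ⊥
      outside-< u<w ((xu , yu) , inj₁ u<x) ((xw , yw) , inj₁ w<x) =
        noncrossing (E-sym xu) (E-sym yw) u<w w<x x<y
      outside-< u<w ((xu , yu) , inj₂ y<u) ((xw , yw) , inj₂ y<w) =
        noncrossing xu yw x<y y<u u<w
      outside-< _   ((xu , yu) , inj₁ u<x) ((xw , yw) , inj₂ y<w) =
        noncrossing (E-sym yu) xw u<x x<y y<w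
      outside-< _   ((xu , yu) , inj₂ y<u) ((xw , yw) , inj₁ w<x) =
        noncrossing (E-sym yw) xu w<x x<y y<u

  common-neighbours-at-most-two : ∀ {x y} → x ≢ y → AtMostTwo (Common x y)
  common-neighbours-at-most-two =
    wlog-< (λ x y → AtMostTwo (Common x y)) swap-centres at-most-two-<
    where
    swap-centres : Symmetric (λ x y → AtMostTwo (Common x y))
    swap-centres atMostTwo u≢v u≢w v≢w cu cv cw = atMostTwo u≢v u≢w v≢w (swap cu) (swap cv) (swap cw)

    at-most-two-< : ∀ {x y} → pos x < pos y → AtMostTwo (Common x y)
    at-most-two-< x<y u≢v u≢w v≢w cu cv cw
      with inside-or-outside x<y cu | inside-or-outside x<y cv | inside-or-outside x<y cw
    ... | inj₁ iu | inj₁ iv | _      = at-most-one-inside x<y u≢v iu iv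
    ... | inj₁ iu | inj₂ _  | inj₁ iw = at-most-one-inside x<y u≢w iu iw
    ... | inj₁ _  | inj₂ ov | inj₂ ow = at-most-one-outside x<y v≢w ov ow
    ... | inj₂ _  | inj₁ iv | inj₁ iw = at-most-one-inside x<y v≢w iv iw
    ... | inj₂ ou | inj₁ _  | inj₂ ow = at-most-one-outside x<y u≢w ou ow
    ... | inj₂ ou | inj₂ ov | _      = at-most-one-outside x<y u≢v ou ov

common-neighbours≤2 : ∀ {n} (G : Graph n) → Outerplanar G → ∀ {x y} → x ≢ y →
  count (λ w → adj G x w ∧ adj G y w) (allFin n) ≤ 2
common-neighbours≤2 {n} G (pos , pos-injective , noncrossing) {x} {y} x≢y =
  count≤2 _ (Unique.allFin⁺ n) λ u≢v u≢w v≢w pu pv pw →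
    common-neighbours-at-most-two x≢y u≢v u≢w v≢w (both-adjacent pu) (both-adjacent pv) (both-adjacent pw)
  where
  Adjacent : Rel (Fin n) 0ℓ
  Adjacent u w = T (adj G u w)

  adjacent-sym : Symmetric Adjacent
  adjacent-sym {u} {w} = subst T (sym G u w)

  adjacent-irrefl : ∀ u → ¬ Adjacent u u
  adjacent-irrefl u = subst T (irrefl G u)

  adjacent-noncrossing : ∀ {a b c d} → Adjacent a b → Adjacent c d →
    pos a <ᶠ pos c → pos c <ᶠ pos b → pos b <ᶠ pos d → ⊥
  adjacent-noncrossing {a} {b} {c} {d} ab cd =
    noncrossing a b c d (Equivalence.to T-≡ ab) (Equivalence.to T-≡ cd)

  open NonCrossing <-cmp Adjacent adjacent-sym adjacent-irrefl pos pos-injective adjacent-noncrossing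

  both-adjacent : ∀ {u} → T (adj G x u ∧ adj G y u) → Common x y u
  both-adjacent = Equivalence.to T-∧

degree-sum≤n+6 : ∀ {n} (G : Graph n) → Outerplanar G → ∀ {x y z} → x ≢ y → x ≢ z → y ≢ z →
  degree G x + degree G y + degree G z ≤ n + 6
degree-sum≤n+6 {n} G outerplanar {x} {y} {z} x≢y x≢z y≢z = begin
  degree G x + degree G y + degree G z
    ≤⟨ count-bonferroni (adj G x) (adj G y) (adj G z) (allFin n) ⟩
  length (allFin n) + common x y + common x z + common y z
    ≤⟨ +-mono-≤ (+-mono-≤ (+-mono-≤ (≤-reflexive (length-tabulate id)) (common≤2 x≢y)) (common≤2 x≢z))
                (common≤2 y≢z) ⟩
  n + 2 + 2 + 2
    ≡⟨ trans (+-assoc (n + 2) 2 2) (+-assoc n 2 4) ⟩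
  n + 6 ∎
  where
  open ≤-Reasoning
  common : Fin n → Fin n → ℕ
  common u w = count (λ v → adj G u v ∧ adj G w v) (allFin n)
  common≤2 : ∀ {u w} → u ≢ w → common u w ≤ 2
  common≤2 = common-neighbours≤2 G outerplanar

#degAtLeast≤2 : ∀ {n} (G : Graph n) → Outerplanar G → ∀ t → n + 6 < 3 * t → #degAtLeast G t ≤ 2
#degAtLeast≤2 {n} G outerplanar t n+6<3t = count≤2 _ (Unique.allFin⁺ n) no-three-of-degree≥t
  where
  no-three-of-degree≥t : AtMostTwo (λ w → T (t ≤ᵇ degree G w))
  no-three-of-degree≥t {x} {y} {z} x≢y x≢z y≢z tx ty tz = <⇒≱ n+6<3t (begin
    3 * t                                 ≡⟨ 3*t≡t+t+t t ⟩
    t + t + t                             ≤⟨ +-mono-≤ (+-mono-≤ (≤ᵇ⇒≤ t _ tx) (≤ᵇ⇒≤ t _ ty)) (≤ᵇ⇒≤ t _ tz) ⟩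
    degree G x + degree G y + degree G z  ≤⟨ degree-sum≤n+6 G outerplanar x≢y x≢z y≢z ⟩
    n + 6                                 ∎)
    where
    open ≤-Reasoning
    3*t≡t+t+t : ∀ t → 3 * t ≡ t + t + t
    3*t≡t+t+t = solve-∀

m≤[m+k]/[1+k]*[1+k] : ∀ m k → m ≤ (m + k) / suc k * suc k
m≤[m+k]/[1+k]*[1+k] m k = +-cancelˡ-≤ k m _ (begin
  k + m                                       ≡⟨ +-comm k m ⟩
  m + k                                       ≡⟨ m≡m%n+[m/n]*n (m + k) (suc k) ⟩
  (m + k) % suc k + (m + k) / suc k * suc k   ≤⟨ +-monoˡ-≤ _ (≤-pred (m%n<n (m + k) (suc k))) ⟩
  k + (m + k) / suc k * suc k                 ∎)
  where open ≤-Reasoning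

2⌈n/6⌉+3≤t⇒n+6<3t : ∀ n {t} → 2 * ⌈ n /6⌉ + 3 ≤ t → n + 6 < 3 * t
2⌈n/6⌉+3≤t⇒n+6<3t n {t} h = begin-strict
  n + 6                  <⟨ +-monoʳ-< n (m<m+n 6 z<s) ⟩
  n + 9                  ≤⟨ +-monoˡ-≤ 9 (m≤[m+k]/[1+k]*[1+k] n 5) ⟩
  ⌈ n /6⌉ * 6 + 9        ≡⟨ regroup ⌈ n /6⌉ ⟩
  3 * (2 * ⌈ n /6⌉ + 3)  ≤⟨ *-monoʳ-≤ 3 h ⟩
  3 * t                  ∎
  where
  open ≤-Reasoning
  regroup : ∀ q → q * 6 + 9 ≡ 3 * (2 * q + 3)
  regroup = solve-∀

lemma9 : (n : ℕ) (G : Graph n) → Outerplanar G →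
    (#degAtLeast G (2 * ⌈ n /6⌉ + 3) ≤ 2) × (#degAtLeast G (2 * ⌈ n /6⌉ + 4) ≤ 2)
lemma9 n G outerplanar =
  #degAtLeast≤2 G outerplanar (2 * ⌈ n /6⌉ + 3) (2⌈n/6⌉+3≤t⇒n+6<3t n ≤-refl) ,
  #degAtLeast≤2 G outerplanar (2 * ⌈ n /6⌉ + 4) (2⌈n/6⌉+3≤t⇒n+6<3t n (+-monoʳ-≤ (2 * ⌈ n /6⌉) (n≤1+n 3)))
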